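{- Let $q$ be a prime power, let $F$ be a field containing $\mathbb{F}_q$, let $d\ge 0$, and let $f(z)=\sum_{i=0}^{d} f_i z^{q^i}\in F[z]$ with $f_d\neq 0$. Put $u=1/z$ and expand $-zf'(z)/f(z)=\sum_{i\ge 0} H_i u^i$ as a power series in $u$. Then for every integer $s$ with $1\le s\le q$ and all integers $k_1,\dots,k_s\ge 1$, $$\prod_{i=1}^s H_{q^{k_i}-1} = H_{q^{k_1}+\dots+q^{k_s}-s}.$$
   Context: Here $f'(z)=f_0$, and $zf'(z)/f(z)=(f_0/f_d)\,u^{q^d-1}\big(1+\sum_{j<d}(f_j/f_d)u^{q^d-q^j}\big)^{ -1}$, which is a power series in $u$. -}

module Defs where

open import Level using (Level; _⊔_) renaming (suc to lsuc)
open import Data.Nat as ℕ using (ℕ; zero; suc; _^_; _∸_; _≥_)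
open import Data.Nat.Primality using (Prime)
open import Data.Fin using (Fin) renaming (zero to fzero; suc to fsuc)
open import Data.Product using (Σ; ∃; _×_; _,_)
open import Relation.Nullary using (¬_)
open import Relation.Binary.PropositionalEquality using (_≡_)
open import Algebra.Bundles using (CommutativeRing)

IsPrimePower : ℕ → Set
IsPrimePower q = Σ ℕ λ p → Σ ℕ λ e → Prime p × e ≥ 1 × q ≡ p ^ e

record Field (c ℓ : Level) : Set (lsuc (c ⊔ ℓ)) where
  field
    commutativeRing : CommutativeRing c ℓ
  open CommutativeRing commutativeRing public
  field
    1≉0     : ¬ (1# ≈ 0#)
    inverse : ∀ x → ¬ (x ≈ 0#) → Σ Carrier λ y → x * y ≈ 1#

module FieldOps {c ℓ : Level} (F : Field c ℓ) where
  open Field F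

  ∑ : (n : ℕ) → (Fin n → Carrier) → Carrier
  ∑ zero    g = 0#
  ∑ (suc n) g = g fzero + ∑ n (λ i → g (fsuc i))

  ∏ : (n : ℕ) → (Fin n → Carrier) → Carrier
  ∏ zero    g = 1#
  ∏ (suc n) g = g fzero * ∏ n (λ i → g (fsuc i))

  ∑ℕ : (n : ℕ) → (Fin n → ℕ) → ℕ
  ∑ℕ zero    g = 0
  ∑ℕ (suc n) g = g fzero ℕ.+ ∑ℕ n (λ i → g (fsuc i))

  -- F contains a subfield with q elements (a copy of 𝔽_q): an injective
  -- map ι : Fin q → F whose image contains 0, 1 and is closed under
  -- +, * and negation (a finite subring of a field is a subfield).
  ContainsFieldOfOrder : ℕ → Set (c ⊔ ℓ)
  ContainsFieldOfOrder q =
    Σ (Fin q → Carrier) λ ι →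
      (∀ i j → ι i ≈ ι j → i ≡ j)
    × (Σ (Fin q) λ i → ι i ≈ 0#)
    × (Σ (Fin q) λ i → ι i ≈ 1#)
    × (∀ i j → Σ (Fin q) λ k → ι k ≈ ι i + ι j)
    × (∀ i j → Σ (Fin q) λ k → ι k ≈ ι i * ι j)
    × (∀ i → Σ (Fin q) λ k → ι k ≈ - ι i)

  -- Coefficient of u^n in f(z)·(Σ_m H_m u^m), shifted by u^{q^d}:
  -- with u = 1/z, f(z) = Σ_{j≤d} f_j u^{-q^j}, so the coefficient of
  -- u^{n - q^d} of the product is Σ_j f_j H_{n + q^j - q^d}
  -- (terms with negative index are absent).
  shiftedTerm : (q d n : ℕ) → ℕ → Carrier → (ℕ → Carrier) → Carrier
  shiftedTerm q d n j fj H with (n ℕ.+ q ^ j) ℕ.<? q ^ d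
  ... | Relation.Nullary.yes _ = 0#
  ... | Relation.Nullary.no  _ = fj * H ((n ℕ.+ q ^ j) ∸ q ^ d)

  -- H is the u-power-series expansion of -z f'(z)/f(z), f'(z) = f_0:
  -- f(z) · Σ_m H_m u^m = -f_0 z = -f_0 u^{-1}, i.e. for every n ≥ 0 the
  -- coefficient of u^{n - q^d} is -f_0 if n = q^d - 1 and 0 otherwise.
  IsExpansion : (q d : ℕ) → (Fin (suc d) → Carrier) → (ℕ → Carrier) → Set ℓ
  IsExpansion q d f H = ∀ n →
    ∑ (suc d) (λ j → shiftedTerm q d n (Data.Fin.toℕ j) (f j) H)
      ≈ rhs n
    where
      rhs : ℕ → Carrier
      rhs n with n ℕ.≟ (q ^ d ∸ 1)
      ... | Relation.Nullary.yes _ = - (f fzero)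
      ... | Relation.Nullary.no  _ = 0#

-- With u = 1/z write f(z) = u^(-q^d) P(u), so that the expansion says H · P = -f₀ u^(q^d-1).
-- Since P(0) = f_d ≠ 0, H vanishes below degree q^d - 1, and Ĥ := H + 1 satisfies
-- Ĥ · P = P₊, the part of P of degree at most q^d - q. In characteristic p the Frobenius
-- gives P^(q^t) = Σ_j f_j^(q^t) u^(q^t (q^d - q^j)), so the coefficient of
-- u^(N + q^(t+d) - 1) in Ĥ · P^(q^t) = P₊ · P^(q^t - 1) vanishes: for all t and N,
--   Σ_j f_j^(q^t) Ĥ(N + q^(t+j) - 1) = 0.
-- As f_d^(q^t) ≠ 0, this recurrence shows that Ĥ(N + q^k - 1) = X Ĥ(q^k - 1) for all k once
-- it holds for k < d. Applied one factor at a time, it reduces the theorem to exponents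
-- below d; then, because s ≤ q, every index stays below q^d - 1, where Ĥ is 1 at 0 and
-- 0 elsewhere, and both sides are equal to 1 or 0 together.

module Submission where

open import Defs
open import Level using (Level; _⊔_)
import Data.Nat as ℕ
open ℕ using (ℕ; zero; suc; _!; _<_; _≤_; _≥_; _∸_; s≤s; z≤n; NonZero)
import Data.Nat.Properties as ℕ
open import Data.Nat.Base using (nonTrivial⇒n>1; nonTrivial⇒≢1)
open import Data.Nat.Divisibility using (_∣_; _∤_; divides; ∣⇒≤; ∣1⇒≡1; m∣m*n)
open import Data.Nat.DivMod using (m/n*n≡m)
open import Data.Nat.Combinatorics using (_C_; nCk≡n!/k![n-k]!; k![n∸k]!∣n!; nCn≡1)
open import Data.Nat.Primality using (Prime; euclidsLemma; prime⇒nonTrivial; prime⇒nonZero)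
open import Data.Nat.Induction using (<-rec)
open import Data.Fin using (Fin; toℕ; fromℕ; inject₁) renaming (zero to fzero; suc to fsuc)
open import Data.Fin.Properties using (toℕ-fromℕ; toℕ-inject₁; toℕ<n) renaming (_≟_ to _≟ᶠ_)
open import Data.Fin.Permutation using (permutation)
import Data.Vec.Functional as Vector
open import Data.Product using (Σ; _,_; proj₁; proj₂)
open import Data.Sum using (inj₁; inj₂)
open import Data.Empty using (⊥-elim)
open import Function using (_∘_)
open import Relation.Nullary using (¬_; yes; no)
open import Relation.Binary.PropositionalEquality as ≡ using (_≡_; _≢_)
open import Relation.Binary.Structures using (IsEquivalence)
open import Algebra.Bundles using (Semiring; CommutativeSemiring)
import Algebra.Properties.CommutativeSemigroup as CommSemigroupProperties

prime>1 : ∀ {p} → Prime p → 1 < p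
prime>1 {p} pr = nonTrivial⇒n>1 p {{prime⇒nonTrivial pr}}

prime∤! : ∀ {p} → Prime p → ∀ m → m < p → p ∤ m !
prime∤! pr zero _ p∣1 = nonTrivial⇒≢1 {{prime⇒nonTrivial pr}} (∣1⇒≡1 p∣1)
prime∤! pr (suc m) m<p p∣m! with euclidsLemma (suc m) (m !) pr p∣m!
... | inj₁ p∣1+m = ℕ.<⇒≱ m<p (∣⇒≤ p∣1+m)
... | inj₂ p∣m!  = prime∤! pr m (ℕ.<-trans (ℕ.n<1+n m) m<p) p∣m!

-- p divides (p C k) · k! · (p - k)! = p!, but neither k! nor (p - k)!.
prime∣C : ∀ {p k} → Prime p → 0 < k → k < p → p ∣ p C k
prime∣C {p@(suc p-1)} {k} pr 0<k k<p
  with euclidsLemma (p C k) (k ! ℕ.* (p ∸ k) !) pr p∣C*k![p∸k]!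
  where
    instance _ = ℕ._!*_!≢0 k (p ∸ k)
    p∣C*k![p∸k]! : p ∣ (p C k) ℕ.* (k ! ℕ.* (p ∸ k) !)
    p∣C*k![p∸k]! = ≡.subst (p ∣_) (≡.sym (≡.trans
      (≡.cong (ℕ._* (k ! ℕ.* (p ∸ k) !)) (nCk≡n!/k![n-k]! (ℕ.<⇒≤ k<p)))
      (m/n*n≡m (k![n∸k]!∣n! (ℕ.<⇒≤ k<p)))))
      (m∣m*n (p-1 !))
... | inj₁ p∣C = p∣C
... | inj₂ p∣k![p∸k]! with euclidsLemma (k !) ((p ∸ k) !) pr p∣k![p∸k]!
...   | inj₁ p∣k! = ⊥-elim (prime∤! pr k k<p p∣k!)
...   | inj₂ p∣[p∸k]! = ⊥-elim (prime∤! pr (p ∸ k) (ℕ.∸-monoʳ-< {p} {k} {0} 0<k (ℕ.<⇒≤ k<p)) p∣[p∸k]!)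

m≤m^n : ∀ m {n} .{{_ : NonZero m}} → 1 ≤ n → m ≤ m ℕ.^ n
m≤m^n m {suc n} _ = ℕ.m≤m*n m (m ℕ.^ n) {{ℕ.m^n≢0 m n}}

n+a<b⇒n<b∸a : ∀ {n a b} → n ℕ.+ a < b → n < b ∸ a
n+a<b⇒n<b∸a {n} {a} {b} n+a<b = ≡.subst (_≤ b ∸ a) (ℕ.m+n∸n≡m (suc n) a) (ℕ.∸-monoˡ-≤ a n+a<b)

n+a≮b⇒b∸a≤n : ∀ {n a b} → ¬ n ℕ.+ a < b → b ∸ a ≤ n
n+a≮b⇒b∸a≤n {n} {a} {b} n+a≮b = ≡.subst (b ∸ a ≤_) (ℕ.m+n∸n≡m n a) (ℕ.∸-monoˡ-≤ a (ℕ.≮⇒≥ n+a≮b))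

[n+a]∸b≡n∸[b∸a] : ∀ n {a b} → a ≤ b → (n ℕ.+ a) ∸ b ≡ n ∸ (b ∸ a)
[n+a]∸b≡n∸[b∸a] n {a} {b} a≤b = ≡.trans
  (≡.cong₂ _∸_ (ℕ.+-comm n a) (≡.sym (ℕ.m+[n∸m]≡n a≤b)))
  (ℕ.[m+n]∸[m+o]≡n∸o a n (b ∸ a))

[a∸b]+[n+[b∸1]]≡n+[a∸1] : ∀ n {a b} → 1 ≤ b → b ≤ a → (a ∸ b) ℕ.+ (n ℕ.+ (b ∸ 1)) ≡ n ℕ.+ (a ∸ 1)
[a∸b]+[n+[b∸1]]≡n+[a∸1] n {a} {b} 1≤b b≤a = ≡.trans (ℕ+.x∙yz≈y∙xz (a ∸ b) n (b ∸ 1))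
  (≡.cong (n ℕ.+_) (≡.trans (≡.sym (ℕ.+-∸-assoc (a ∸ b) 1≤b)) (≡.cong (_∸ 1) (ℕ.m∸n+n≡m b≤a))))
  where module ℕ+ = CommSemigroupProperties ℕ.+-commutativeSemigroup

[a∸q]+b<n+[a+b∸1] : ∀ n {a q} b → 1 < q → q ≤ a → (a ∸ q) ℕ.+ b < n ℕ.+ (a ℕ.+ b ∸ 1)
[a∸q]+b<n+[a+b∸1] n {a} {q} b 1<q q≤a = begin-strict
  (a ∸ q) ℕ.+ b         <⟨ ℕ.+-monoˡ-< b (ℕ.∸-monoʳ-< 1<q q≤a) ⟩
  (a ∸ 1) ℕ.+ b         ≡⟨ ℕ.+-∸-comm b (ℕ.≤-trans (ℕ.<⇒≤ 1<q) q≤a) ⟨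
  a ℕ.+ b ∸ 1           ≤⟨ ℕ.m≤n+m _ n ⟩
  n ℕ.+ (a ℕ.+ b ∸ 1)   ∎
  where open ℕ.≤-Reasoning


module Frobenius {a ℓ} (S : Semiring a ℓ) where
  open Semiring S
  open import Algebra.Properties.Semiring.Mult S
  open import Algebra.Properties.Semiring.Exp S
  open import Algebra.Properties.Semiring.Sum S
  open import Algebra.Properties.Semiring.Binomial S using (binomialTerm; theorem)
  open import Relation.Binary.Reasoning.Setoid setoid

  Central : Carrier → Set (a ⊔ ℓ)
  Central x = ∀ y → x * y ≈ y * x

  ^-central : ∀ {x} n → Central x → Central (x ^ n)
  ^-central zero    x-central y = trans (*-identityˡ y) (sym (*-identityʳ y))
  ^-central {x} (suc n) x-central y = begin
    (x * x ^ n) * y  ≈⟨ *-assoc x (x ^ n) y ⟩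
    x * (x ^ n * y)  ≈⟨ *-congˡ (^-central n x-central y) ⟩
    x * (y * x ^ n)  ≈⟨ *-assoc x y (x ^ n) ⟨
    (x * y) * x ^ n  ≈⟨ *-congʳ (x-central y) ⟩
    (y * x) * x ^ n  ≈⟨ *-assoc y x (x ^ n) ⟩
    y * (x * x ^ n)  ∎

  sum-≈0 : ∀ {n} (x : Fin n → Carrier) → (∀ i → x i ≈ 0#) → sum x ≈ 0#
  sum-≈0 {n} x x≈0 = trans (sum-cong-≋ x≈0) (sum-replicate-zero n)

  module _ {p} (p-prime : Prime p) (char : p × 1# ≈ 0#) where

    p∣n⇒n×x≈0 : ∀ {n} → p ∣ n → ∀ x → n × x ≈ 0#
    p∣n⇒n×x≈0 (divides m ≡.refl) x = begin
      (m ℕ.* p) × x              ≈⟨ ×-congʳ (m ℕ.* p) (*-identityˡ x) ⟨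
      (m ℕ.* p) × (1# * x)       ≈⟨ ×-assoc-* (m ℕ.* p) 1# x ⟨
      ((m ℕ.* p) × 1#) * x       ≈⟨ *-congʳ (×1-homo-* m p) ⟩
      ((m × 1#) * (p × 1#)) * x  ≈⟨ *-congʳ (*-congˡ char) ⟩
      ((m × 1#) * 0#) * x        ≈⟨ *-congʳ (zeroʳ _) ⟩
      0# * x                     ≈⟨ zeroˡ x ⟩
      0#                         ∎

    ^p-distrib-+ : ∀ x y → x * y ≈ y * x → (x + y) ^ p ≈ x ^ p + y ^ p
    ^p-distrib-+ x y xy≈yx = frobenius p ≡.refl
      where
      p∣C : ∀ {n k} → n ≡ p → 0 < k → k < n → p ∣ n C k
      p∣C ≡.refl = prime∣C p-prime
      frobenius : ∀ n → n ≡ p → (x + y) ^ n ≈ x ^ n + y ^ n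
      frobenius zero    0≡p = ⊥-elim (ℕ.<⇒≢ (ℕ.<-trans (s≤s z≤n) (prime>1 p-prime)) 0≡p)
      frobenius (suc n) n≡p = begin
        (x + y) ^ suc n                                     ≈⟨ theorem x y xy≈yx (suc n) ⟩
        term fzero + sum (term ∘ fsuc)                       ≈⟨ +-congˡ (sum-init-last (term ∘ fsuc)) ⟩
        term fzero + (sum (term ∘ fsuc ∘ inject₁) + term (fromℕ (suc n)))
          ≈⟨ +-cong first≈ (+-cong (sum-≈0 _ middle≈0) last≈) ⟩
        y ^ suc n + (0# + x ^ suc n)                         ≈⟨ +-congˡ (+-identityˡ _) ⟩
        y ^ suc n + x ^ suc n                                ≈⟨ +-comm _ _ ⟩
        x ^ suc n + y ^ suc n                                ∎
        where
        term = binomialTerm x y (suc n)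
        first≈ : term fzero ≈ y ^ suc n
        first≈ = trans (×-homo-1 _) (*-identityˡ _)
        middle≈0 : ∀ i → term (fsuc (inject₁ i)) ≈ 0#
        middle≈0 i = p∣n⇒n×x≈0 (p∣C n≡p (s≤s z≤n) (s≤s i<n)) _
          where i<n = ≡.subst (_< n) (≡.sym (toℕ-inject₁ i)) (toℕ<n i)
        last≈ : term (fromℕ (suc n)) ≈ x ^ suc n
        last≈ = begin
          term (fromℕ (suc n))
            ≈⟨ ×-cong (≡.cong (suc n C_) top) (*-cong (^-congʳ x top) (^-congʳ y (≡.cong (suc n ∸_) top))) ⟩
          (suc n C suc n) × (x ^ suc n * y ^ (suc n ∸ suc n))
            ≈⟨ ×-cong (nCn≡1 (suc n)) (*-congˡ (^-congʳ y (ℕ.n∸n≡0 n))) ⟩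
          1 × (x ^ suc n * 1#)  ≈⟨ ×-homo-1 _ ⟩
          x ^ suc n * 1#        ≈⟨ *-identityʳ _ ⟩
          x ^ suc n             ∎
          where top = toℕ-fromℕ (suc n)

    0^p≈0 : 0# ^ p ≈ 0#
    0^p≈0 = trans (^-congʳ 0# (≡.sym (ℕ.suc-pred p {{prime⇒nonZero p-prime}}))) (zeroˡ _)

    ^p-distrib-sum : ∀ {n} (x : Fin n → Carrier) → (∀ i → Central (x i)) →
                     sum x ^ p ≈ sum (λ i → x i ^ p)
    ^p-distrib-sum {zero}  x _       = 0^p≈0
    ^p-distrib-sum {suc n} x central = trans
      (^p-distrib-+ (x fzero) (sum (x ∘ fsuc)) (central fzero _))
      (+-congˡ (^p-distrib-sum (x ∘ fsuc) (central ∘ fsuc)))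

    ^[p^N]-distrib-sum : ∀ N {n} (x : Fin n → Carrier) → (∀ i → Central (x i)) →
                         sum x ^ (p ℕ.^ N) ≈ sum (λ i → x i ^ (p ℕ.^ N))
    ^[p^N]-distrib-sum zero    x _       = trans (*-identityʳ _) (sum-cong-≋ (λ i → sym (*-identityʳ (x i))))
    ^[p^N]-distrib-sum (suc N) x central = begin
      sum x ^ (p ℕ.* p ℕ.^ N)               ≈⟨ ^-assocʳ (sum x) p (p ℕ.^ N) ⟨
      (sum x ^ p) ^ (p ℕ.^ N)               ≈⟨ ^-congˡ (p ℕ.^ N) (^p-distrib-sum x central) ⟩
      sum (λ i → x i ^ p) ^ (p ℕ.^ N)       ≈⟨ ^[p^N]-distrib-sum N (λ i → x i ^ p) (λ i → ^-central p (central i)) ⟩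
      sum (λ i → (x i ^ p) ^ (p ℕ.^ N))     ≈⟨ sum-cong-≋ (λ i → ^-assocʳ (x i) p (p ℕ.^ N)) ⟩
      sum (λ i → x i ^ (p ℕ.* p ℕ.^ N))     ∎

module PowerSeries {c ℓ} (R : CommutativeSemiring c ℓ) where
  open CommutativeSemiring R
  open import Algebra.Solver.Ring.NaturalCoefficients.Default R
  open import Relation.Binary.Reasoning.Setoid setoid

  Series : Set c
  Series = ℕ → Carrier

  infix  4 _≋_
  infixl 6 _⊕_
  infixl 7 _⊛_
  infixr 8 _⊙_

  _≋_ : Series → Series → Set ℓ
  a ≋ b = ∀ n → a n ≈ b n

  _⊕_ : Series → Series → Series
  (a ⊕ b) n = a n + b n

  _⊙_ : Carrier → Series → Series
  (x ⊙ a) n = x * a n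

  𝟘 𝟙 : Series
  𝟘 n = 0#
  𝟙 zero    = 1#
  𝟙 (suc n) = 0#

  tail : Series → Series
  tail a n = a (suc n)

  -- The Cauchy product, by recursion on the first factor: a ⊛ b = a 0 ⊙ b ⊕ u · (tail a ⊛ b).
  _⊛_ : Series → Series → Series
  (a ⊛ b) zero    = a 0 * b 0
  (a ⊛ b) (suc n) = a 0 * b (suc n) + (tail a ⊛ b) n

  ≋-isEquivalence : IsEquivalence _≋_
  ≋-isEquivalence = record
    { refl  = λ n → refl
    ; sym   = λ a≋b n → sym (a≋b n)
    ; trans = λ a≋b b≋c n → trans (a≋b n) (b≋c n)
    }

  open IsEquivalence ≋-isEquivalence public
    using () renaming (refl to ≋-refl; sym to ≋-sym; trans to ≋-trans)

  ⊕-cong : ∀ {a a′ b b′} → a ≋ a′ → b ≋ b′ → a ⊕ b ≋ a′ ⊕ b′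
  ⊕-cong a≋a′ b≋b′ n = +-cong (a≋a′ n) (b≋b′ n)

  ⊙-cong : ∀ x {a b} → a ≋ b → x ⊙ a ≋ x ⊙ b
  ⊙-cong x a≋b n = *-congˡ (a≋b n)

  ⊛-cong : ∀ {a a′ b b′} → a ≋ a′ → b ≋ b′ → a ⊛ b ≋ a′ ⊛ b′
  ⊛-cong a≋a′ b≋b′ zero    = *-cong (a≋a′ 0) (b≋b′ 0)
  ⊛-cong a≋a′ b≋b′ (suc n) = +-cong (*-cong (a≋a′ 0) (b≋b′ (suc n))) (⊛-cong (a≋a′ ∘ suc) b≋b′ n)

  ⊛-zeroˡ : ∀ b → 𝟘 ⊛ b ≋ 𝟘
  ⊛-zeroˡ b zero    = zeroˡ (b 0)
  ⊛-zeroˡ b (suc n) = trans (+-cong (zeroˡ _) (⊛-zeroˡ b n)) (+-identityʳ 0#)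

  ⊛-zeroʳ : ∀ a → a ⊛ 𝟘 ≋ 𝟘
  ⊛-zeroʳ a zero    = zeroʳ (a 0)
  ⊛-zeroʳ a (suc n) = trans (+-cong (zeroʳ _) (⊛-zeroʳ (tail a) n)) (+-identityʳ 0#)

  ⊛-identityˡ : ∀ b → 𝟙 ⊛ b ≋ b
  ⊛-identityˡ b zero    = *-identityˡ (b 0)
  ⊛-identityˡ b (suc n) = trans (+-cong (*-identityˡ _) (⊛-zeroˡ b n)) (+-identityʳ _)

  ⊛-identityʳ : ∀ a → a ⊛ 𝟙 ≋ a
  ⊛-identityʳ a zero    = *-identityʳ (a 0)
  ⊛-identityʳ a (suc n) = trans (+-cong (zeroʳ _) (⊛-identityʳ (tail a) n)) (+-identityˡ _)

  ⊛-distribʳ : ∀ a b e → (a ⊕ b) ⊛ e ≋ a ⊛ e ⊕ b ⊛ e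
  ⊛-distribʳ a b e zero    = distribʳ (e 0) (a 0) (b 0)
  ⊛-distribʳ a b e (suc n) = trans (+-congˡ (⊛-distribʳ (tail a) (tail b) e n))
    (solve 5 (λ x y z u v → (x :+ y) :* z :+ (u :+ v) := (x :* z :+ u) :+ (y :* z :+ v)) refl
      (a 0) (b 0) (e (suc n)) ((tail a ⊛ e) n) ((tail b ⊛ e) n))

  ⊛-distribˡ : ∀ a b e → a ⊛ (b ⊕ e) ≋ a ⊛ b ⊕ a ⊛ e
  ⊛-distribˡ a b e zero    = distribˡ (a 0) (b 0) (e 0)
  ⊛-distribˡ a b e (suc n) = trans (+-congˡ (⊛-distribˡ (tail a) b e n))
    (solve 5 (λ x y z u v → x :* (y :+ z) :+ (u :+ v) := (x :* y :+ u) :+ (x :* z :+ v)) refl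
      (a 0) (b (suc n)) (e (suc n)) ((tail a ⊛ b) n) ((tail a ⊛ e) n))

  ⊙-⊛ : ∀ x a b → (x ⊙ a) ⊛ b ≋ x ⊙ (a ⊛ b)
  ⊙-⊛ x a b zero    = *-assoc x (a 0) (b 0)
  ⊙-⊛ x a b (suc n) = trans (+-congˡ (⊙-⊛ x (tail a) b n))
    (solve 4 (λ x y z w → (x :* y) :* z :+ x :* w := x :* (y :* z :+ w)) refl
      x (a 0) (b (suc n)) ((tail a ⊛ b) n))

  ⊛-⊙ : ∀ x a b → a ⊛ (x ⊙ b) ≋ x ⊙ (a ⊛ b)
  ⊛-⊙ x a b zero    = x∙yz≈y∙xz (a 0) x (b 0)
    where open CommSemigroupProperties *-commutativeSemigroup using (x∙yz≈y∙xz)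
  ⊛-⊙ x a b (suc n) = trans (+-congˡ (⊛-⊙ x (tail a) b n))
    (solve 4 (λ x y z w → y :* (x :* z) :+ x :* w := x :* (y :* z :+ w)) refl
      x (a 0) (b (suc n)) ((tail a ⊛ b) n))

  ⊛-assoc : ∀ a b e → (a ⊛ b) ⊛ e ≋ a ⊛ (b ⊛ e)
  ⊛-assoc a b e zero    = *-assoc (a 0) (b 0) (e 0)
  ⊛-assoc a b e (suc n) = begin
    -- tail (a ⊛ b) is a 0 ⊙ tail b ⊕ tail a ⊛ b by definition
    (a 0 * b 0) * e (suc n) + ((a 0 ⊙ tail b ⊕ tail a ⊛ b) ⊛ e) n
      ≈⟨ +-congˡ (⊛-distribʳ (a 0 ⊙ tail b) (tail a ⊛ b) e n) ⟩
    (a 0 * b 0) * e (suc n) + (((a 0 ⊙ tail b) ⊛ e) n + ((tail a ⊛ b) ⊛ e) n)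
      ≈⟨ +-congˡ (+-cong (⊙-⊛ (a 0) (tail b) e n) (⊛-assoc (tail a) b e n)) ⟩
    (a 0 * b 0) * e (suc n) + (a 0 * (tail b ⊛ e) n + (tail a ⊛ (b ⊛ e)) n)
      ≈⟨ solve 5 (λ x y z u v → (x :* y) :* z :+ (x :* u :+ v) := x :* (y :* z :+ u) :+ v) refl
           (a 0) (b 0) (e (suc n)) ((tail b ⊛ e) n) ((tail a ⊛ (b ⊛ e)) n) ⟩
    a 0 * (b 0 * e (suc n) + (tail b ⊛ e) n) + (tail a ⊛ (b ⊛ e)) n ∎

  ⊕-⊛-semiring : Semiring c ℓ
  ⊕-⊛-semiring = record
    { Carrier = Series ; _≈_ = _≋_ ; _+_ = _⊕_ ; _*_ = _⊛_ ; 0# = 𝟘 ; 1# = 𝟙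
    ; isSemiring = record
      { isSemiringWithoutAnnihilatingZero = record
        { +-isCommutativeMonoid = record
          { isMonoid = record
            { isSemigroup = record
              { isMagma = record { isEquivalence = ≋-isEquivalence ; ∙-cong = ⊕-cong }
              ; assoc   = λ a b e n → +-assoc (a n) (b n) (e n)
              }
            ; identity = (λ a n → +-identityˡ (a n)) , (λ a n → +-identityʳ (a n))
            }
          ; comm = λ a b n → +-comm (a n) (b n)
          }
        ; *-cong     = ⊛-cong
        ; *-assoc    = ⊛-assoc
        ; *-identity = ⊛-identityˡ , ⊛-identityʳ
        ; distrib    = (λ a b e → ⊛-distribˡ a b e) , (λ a b e → ⊛-distribʳ b e a)
        }
      ; zero = ⊛-zeroˡ , ⊛-zeroʳ
      }
    }

  open import Algebra.Properties.Semiring.Exp semiring using (_^_)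
  open import Algebra.Properties.Semiring.Mult semiring using (_×_; ×-comm-*; ×-congʳ)
  open import Algebra.Properties.Semiring.Sum semiring using (sum)
  open import Algebra.Properties.Semiring.Exp ⊕-⊛-semiring using () renaming (_^_ to _^ₛ_)
  open import Algebra.Properties.Semiring.Mult ⊕-⊛-semiring using () renaming (_×_ to _×ₛ_)
  open import Algebra.Properties.Semiring.Sum ⊕-⊛-semiring using () renaming (sum to sumₛ)
  open Frobenius ⊕-⊛-semiring using (Central)

  𝟙-+ : ∀ m n → 𝟙 (m ℕ.+ n) ≈ 𝟙 m * 𝟙 n
  𝟙-+ zero    n = sym (*-identityˡ (𝟙 n))
  𝟙-+ (suc m) n = sym (zeroˡ (𝟙 n))

  ⊕𝟙-coeff : ∀ a {n} → 1 ≤ n → (a ⊕ 𝟙) n ≈ a n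
  ⊕𝟙-coeff a (s≤s _) = +-identityʳ _

  ×ₛ-coeff : ∀ n a i → (n ×ₛ a) i ≈ n × a i
  ×ₛ-coeff zero    a i = refl
  ×ₛ-coeff (suc n) a i = +-congˡ (×ₛ-coeff n a i)

  ×ₛ-𝟙≋𝟘 : ∀ {n} → n × 1# ≈ 0# → n ×ₛ 𝟙 ≋ 𝟘
  ×ₛ-𝟙≋𝟘 {n} n×1≈0 zero    = trans (×ₛ-coeff n 𝟙 0) n×1≈0
  ×ₛ-𝟙≋𝟘 {n} n×1≈0 (suc i) = begin
    (n ×ₛ 𝟙) (suc i)  ≈⟨ ×ₛ-coeff n 𝟙 (suc i) ⟩
    n × 0#            ≈⟨ ×-congʳ n (zeroˡ 1#) ⟨
    n × (0# * 1#)     ≈⟨ ×-comm-* n 0# 1# ⟨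
    0# * (n × 1#)     ≈⟨ zeroˡ _ ⟩
    0#                ∎

  sumₛ-coeff : ∀ {n} (g : Fin n → Series) i → sumₛ g i ≈ sum (λ j → g j i)
  sumₛ-coeff {zero}  g i = refl
  sumₛ-coeff {suc n} g i = +-congˡ (sumₛ-coeff (g ∘ fsuc) i)

  shift : ℕ → Series → Series
  shift zero    a n       = a n
  shift (suc m) a zero    = 0#
  shift (suc m) a (suc n) = shift m a n

  shift-cong : ∀ m {a b} → a ≋ b → shift m a ≋ shift m b
  shift-cong zero    a≋b n       = a≋b n
  shift-cong (suc m) a≋b zero    = refl
  shift-cong (suc m) a≋b (suc n) = shift-cong m a≋b n

  shift-< : ∀ m a {n} → n < m → shift m a n ≡ 0#
  shift-< (suc m) a {zero}  _         = ≡.refl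
  shift-< (suc m) a {suc n} (s≤s n<m) = shift-< m a n<m

  shift-≥ : ∀ m a {n} → m ≤ n → shift m a n ≡ a (n ∸ m)
  shift-≥ zero    a _         = ≡.refl
  shift-≥ (suc m) a (s≤s m≤n) = shift-≥ m a m≤n

  shift-+ : ∀ m a i → shift m a (m ℕ.+ i) ≡ a i
  shift-+ zero    a i = ≡.refl
  shift-+ (suc m) a i = shift-+ m a i

  shift-suc : ∀ m a → shift (suc m) a ≋ shift 1 (shift m a)
  shift-suc m a zero    = refl
  shift-suc m a (suc n) = refl

  shift-shift : ∀ m k a → shift m (shift k a) ≋ shift (m ℕ.+ k) a
  shift-shift zero    k a n       = refl
  shift-shift (suc m) k a zero    = refl
  shift-shift (suc m) k a (suc n) = shift-shift m k a n

  shift-⊕ : ∀ m a b → shift m a ⊕ shift m b ≋ shift m (a ⊕ b)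
  shift-⊕ zero    a b n       = refl
  shift-⊕ (suc m) a b zero    = +-identityʳ 0#
  shift-⊕ (suc m) a b (suc n) = shift-⊕ m a b n

  shift-𝟘 : ∀ m → shift m 𝟘 ≋ 𝟘
  shift-𝟘 zero    n       = refl
  shift-𝟘 (suc m) zero    = refl
  shift-𝟘 (suc m) (suc n) = shift-𝟘 m n

  ⊙-shift : ∀ x m a → x ⊙ shift m a ≋ shift m (x ⊙ a)
  ⊙-shift x zero    a n       = refl
  ⊙-shift x (suc m) a zero    = zeroʳ x
  ⊙-shift x (suc m) a (suc n) = ⊙-shift x m a n

  shift1-⊛ : ∀ a b → shift 1 a ⊛ b ≋ shift 1 (a ⊛ b)
  shift1-⊛ a b zero    = zeroˡ (b 0)
  shift1-⊛ a b (suc n) = trans (+-congʳ (zeroˡ _)) (+-identityˡ _)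

  ⊛-shift1 : ∀ a b → a ⊛ shift 1 b ≋ shift 1 (a ⊛ b)
  ⊛-shift1 a b zero          = zeroʳ (a 0)
  ⊛-shift1 a b (suc zero)    = trans (+-congˡ (zeroʳ _)) (+-identityʳ _)
  ⊛-shift1 a b (suc (suc n)) = +-congˡ (⊛-shift1 (tail a) b (suc n))

  shift-⊛ : ∀ m a b → shift m a ⊛ b ≋ shift m (a ⊛ b)
  shift-⊛ zero    a b = ≋-refl
  shift-⊛ (suc m) a b = ≋-trans (⊛-cong (shift-suc m a) ≋-refl)
    (≋-trans (shift1-⊛ (shift m a) b) (≋-trans (shift-cong 1 (shift-⊛ m a b)) (≋-sym (shift-suc m (a ⊛ b)))))

  ⊛-shift : ∀ m a b → a ⊛ shift m b ≋ shift m (a ⊛ b)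
  ⊛-shift zero    a b = ≋-refl
  ⊛-shift (suc m) a b = ≋-trans (⊛-cong ≋-refl (shift-suc m b))
    (≋-trans (⊛-shift1 a (shift m b)) (≋-trans (shift-cong 1 (⊛-shift m a b)) (≋-sym (shift-suc m (a ⊛ b)))))

  monomial : Carrier → ℕ → Series
  monomial x m = shift m (x ⊙ 𝟙)

  monomial-cong : ∀ {x y} m → x ≈ y → monomial x m ≋ monomial y m
  monomial-cong m x≈y = shift-cong m (λ n → *-congʳ x≈y)

  monomial-at : ∀ x m → monomial x m m ≈ x
  monomial-at x zero    = *-identityʳ x
  monomial-at x (suc m) = monomial-at x m

  monomial-≢ : ∀ x m {n} → n ≢ m → monomial x m n ≈ 0#
  monomial-≢ x zero    {zero}  n≢m = ⊥-elim (n≢m ≡.refl)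
  monomial-≢ x zero    {suc n} n≢m = zeroʳ x
  monomial-≢ x (suc m) {zero}  n≢m = refl
  monomial-≢ x (suc m) {suc n} n≢m = monomial-≢ x m (n≢m ∘ ≡.cong suc)

  monomial-+ : ∀ x y m → monomial x m ⊕ monomial y m ≋ monomial (x + y) m
  monomial-+ x y m = ≋-trans (shift-⊕ m (x ⊙ 𝟙) (y ⊙ 𝟙)) (shift-cong m (λ n → sym (distribʳ (𝟙 n) x y)))

  monomial-0# : ∀ m → monomial 0# m ≋ 𝟘
  monomial-0# m = ≋-trans (shift-cong m (λ n → zeroˡ (𝟙 n))) (shift-𝟘 m)

  ⊛-monomial : ∀ a x m → a ⊛ monomial x m ≋ shift m (x ⊙ a)
  ⊛-monomial a x m = ≋-trans (⊛-shift m a (x ⊙ 𝟙))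
    (shift-cong m (≋-trans (⊛-⊙ x a 𝟙) (⊙-cong x (⊛-identityʳ a))))

  monomial-⊛ : ∀ x m a → monomial x m ⊛ a ≋ shift m (x ⊙ a)
  monomial-⊛ x m a = ≋-trans (shift-⊛ m (x ⊙ 𝟙) a)
    (shift-cong m (≋-trans (⊙-⊛ x 𝟙 a) (⊙-cong x (⊛-identityˡ a))))

  monomial-central : ∀ x m → Central (monomial x m)
  monomial-central x m a = ≋-trans (monomial-⊛ x m a) (≋-sym (⊛-monomial a x m))

  monomial-⊛-monomial : ∀ x m y k → monomial x m ⊛ monomial y k ≋ monomial (x * y) (m ℕ.+ k)
  monomial-⊛-monomial x m y k = ≋-trans (monomial-⊛ x m (monomial y k))
    (≋-trans (shift-cong m (⊙-shift x k (y ⊙ 𝟙)))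
    (≋-trans (shift-cong m (shift-cong k (λ n → sym (*-assoc x y (𝟙 n)))))
      (shift-shift m k ((x * y) ⊙ 𝟙))))

  monomial-^ₛ : ∀ x m n → monomial x m ^ₛ n ≋ monomial (x ^ n) (n ℕ.* m)
  monomial-^ₛ x m zero    = λ i → sym (*-identityˡ (𝟙 i))
  monomial-^ₛ x m (suc n) = ≋-trans (⊛-cong ≋-refl (monomial-^ₛ x m n))
    (monomial-⊛-monomial x m (x ^ n) (n ℕ.* m))

  ⊛-sumₛ-monomial : ∀ a {n} (x : Fin n → Carrier) (m : Fin n → ℕ) i →
    (a ⊛ sumₛ (λ j → monomial (x j) (m j))) i ≈ sum (λ j → shift (m j) (x j ⊙ a) i)
  ⊛-sumₛ-monomial a x m i = begin
    (a ⊛ sumₛ (λ j → monomial (x j) (m j))) i  ≈⟨ *-distribˡ-sum a (λ j → monomial (x j) (m j)) i ⟩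
    sumₛ (λ j → a ⊛ monomial (x j) (m j)) i    ≈⟨ sumₛ-coeff (λ j → a ⊛ monomial (x j) (m j)) i ⟩
    sum (λ j → (a ⊛ monomial (x j) (m j)) i)   ≈⟨ sum-cong-≋ (λ j → ⊛-monomial a (x j) (m j) i) ⟩
    sum (λ j → shift (m j) (x j ⊙ a) i)        ∎
    where
    open import Algebra.Properties.Semiring.Sum ⊕-⊛-semiring using (*-distribˡ-sum)
    open import Algebra.Properties.Semiring.Sum semiring using (sum-cong-≋)

  Degree≤ : Series → ℕ → Set ℓ
  Degree≤ a D = ∀ n → D < n → a n ≈ 0#

  degree-resp : ∀ {a b D} → a ≋ b → Degree≤ b D → Degree≤ a D
  degree-resp a≋b b≤D n D<n = trans (a≋b n) (b≤D n D<n)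

  degree-weaken : ∀ {a D E} → Degree≤ a D → D ≤ E → Degree≤ a E
  degree-weaken a≤D D≤E n E<n = a≤D n (ℕ.≤-<-trans D≤E E<n)

  degree-⊕ : ∀ {a b D} → Degree≤ a D → Degree≤ b D → Degree≤ (a ⊕ b) D
  degree-⊕ a≤D b≤D n D<n = trans (+-cong (a≤D n D<n) (b≤D n D<n)) (+-identityʳ 0#)

  degree-𝟘 : ∀ D → Degree≤ 𝟘 D
  degree-𝟘 D n _ = refl

  degree-𝟙 : Degree≤ 𝟙 0
  degree-𝟙 (suc n) _ = refl

  degree-⊙ : ∀ x {a D} → Degree≤ a D → Degree≤ (x ⊙ a) D
  degree-⊙ x a≤D n D<n = trans (*-congˡ (a≤D n D<n)) (zeroʳ x)

  degree-shift : ∀ m {a D} → Degree≤ a D → Degree≤ (shift m a) (m ℕ.+ D)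
  degree-shift zero    a≤D n       D<n       = a≤D n D<n
  degree-shift (suc m) a≤D (suc n) (s≤s D<n) = degree-shift m a≤D n D<n

  degree-monomial : ∀ x m → Degree≤ (monomial x m) m
  degree-monomial x m = degree-weaken (degree-shift m (degree-⊙ x degree-𝟙)) (ℕ.≤-reflexive (ℕ.+-identityʳ m))

  degree-⊛ : ∀ {a b} A B → Degree≤ a A → Degree≤ b B → Degree≤ (a ⊛ b) (A ℕ.+ B)
  degree-⊛ {a} {b} zero B a≤0 b≤B (suc n) (s≤s B≤n) = begin
    a 0 * b (suc n) + (tail a ⊛ b) n  ≈⟨ +-cong (*-congˡ (b≤B (suc n) (s≤s B≤n))) (⊛-cong tail-a≋𝟘 ≋-refl n) ⟩
    a 0 * 0# + (𝟘 ⊛ b) n              ≈⟨ +-cong (zeroʳ _) (⊛-zeroˡ b n) ⟩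
    0# + 0#                           ≈⟨ +-identityʳ 0# ⟩
    0#                                ∎
    where tail-a≋𝟘 = λ i → a≤0 (suc i) (s≤s z≤n)
  degree-⊛ {a} {b} (suc A) B a≤A b≤B (suc n) (s≤s A+B<n) = begin
    a 0 * b (suc n) + (tail a ⊛ b) n
      ≈⟨ +-cong (*-congˡ (b≤B (suc n) B<1+n)) (degree-⊛ A B (λ i → a≤A (suc i) ∘ s≤s) b≤B n A+B<n) ⟩
    a 0 * 0# + 0#                     ≈⟨ +-identityʳ _ ⟩
    a 0 * 0#                          ≈⟨ zeroʳ _ ⟩
    0#                                ∎
    where B<1+n = ℕ.<-trans (ℕ.≤-<-trans (ℕ.m≤n+m B A) A+B<n) (ℕ.n<1+n n)

  degree-^ₛ : ∀ {a D} n → Degree≤ a D → Degree≤ (a ^ₛ n) (n ℕ.* D)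
  degree-^ₛ zero    a≤D = degree-𝟙
  degree-^ₛ {D = D} (suc n) a≤D = degree-⊛ D (n ℕ.* D) a≤D (degree-^ₛ n a≤D)

  degree-sumₛ : ∀ {n} (g : Fin n → Series) {D} → (∀ j → Degree≤ (g j) D) → Degree≤ (sumₛ g) D
  degree-sumₛ {zero}  g g≤D = degree-𝟘 _
  degree-sumₛ {suc n} g g≤D = degree-⊕ (g≤D fzero) (degree-sumₛ (g ∘ fsuc) (g≤D ∘ fsuc))

  Order≥ : Series → ℕ → Set ℓ
  Order≥ a n = ∀ i → i < n → a i ≈ 0#

  order-⊛-cancelʳ : ∀ {b} → (∀ x → x * b 0 ≈ 0# → x ≈ 0#) →
                    ∀ n {a} → Order≥ (a ⊛ b) n → Order≥ a n
  order-⊛-cancelʳ {b} b₀-regular (suc n) {a} ab≥1+n = a≥1+n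
    where
    a₀≈0 : a 0 ≈ 0#
    a₀≈0 = b₀-regular (a 0) (ab≥1+n 0 (s≤s z≤n))
    tail-a⊛b≥n : Order≥ (tail a ⊛ b) n
    tail-a⊛b≥n j j<n = begin
      (tail a ⊛ b) j                    ≈⟨ +-identityˡ _ ⟨
      0# + (tail a ⊛ b) j               ≈⟨ +-congʳ (trans (*-congʳ a₀≈0) (zeroˡ _)) ⟨
      a 0 * b (suc j) + (tail a ⊛ b) j  ≈⟨ ab≥1+n (suc j) (s≤s j<n) ⟩
      0#                                ∎
    a≥1+n : Order≥ a (suc n)
    a≥1+n zero    _         = a₀≈0
    a≥1+n (suc i) (s≤s i<n) = order-⊛-cancelʳ b₀-regular n tail-a⊛b≥n i i<n

module FieldProperties {c ℓ} (F : Field c ℓ) where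
  open Field F
  open FieldOps F
  open import Algebra.Properties.Ring ring using (-‿distribʳ-*; +-inverseʳ-unique)
  open import Algebra.Properties.Semiring.Exp semiring using (_^_)
  open import Algebra.Properties.Semiring.Sum semiring using (sum; sum-init-last; sum-cong-≋; *-distribˡ-sum)
  open import Relation.Binary.Reasoning.Setoid setoid

  ∑≡sum : ∀ n (g : Fin n → Carrier) → ∑ n g ≡ sum g
  ∑≡sum zero    g = ≡.refl
  ∑≡sum (suc n) g = ≡.cong (g fzero +_) (∑≡sum n (g ∘ fsuc))

  ∏-cong : ∀ n {g h : Fin n → Carrier} → (∀ i → g i ≈ h i) → ∏ n g ≈ ∏ n h
  ∏-cong zero    g≈h = refl
  ∏-cong (suc n) g≈h = *-cong (g≈h fzero) (∏-cong n (g≈h ∘ fsuc))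

  ∑ℕ-≤ : ∀ n (g : Fin n → ℕ) {b} → (∀ i → g i ≤ b) → ∑ℕ n g ≤ n ℕ.* b
  ∑ℕ-≤ zero    g g≤b = z≤n
  ∑ℕ-≤ (suc n) g g≤b = ℕ.+-mono-≤ (g≤b fzero) (∑ℕ-≤ n (g ∘ fsuc) (g≤b ∘ fsuc))

  ∑ℕ[g∸1]+n≡∑ℕg : ∀ n (g : Fin n → ℕ) → (∀ i → 1 ≤ g i) → ∑ℕ n (λ i → g i ∸ 1) ℕ.+ n ≡ ∑ℕ n g
  ∑ℕ[g∸1]+n≡∑ℕg zero    g g≥1 = ≡.refl
  ∑ℕ[g∸1]+n≡∑ℕg (suc n) g g≥1 = ≡.trans (ℕ.+-suc _ n) (≡.trans (≡.cong suc (ℕ.+-assoc (g fzero ∸ 1) _ n))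
    (≡.cong₂ ℕ._+_ (ℕ.suc-pred (g fzero) {{ℕ.>-nonZero (g≥1 fzero)}})
                   (∑ℕ[g∸1]+n≡∑ℕg n (g ∘ fsuc) (g≥1 ∘ fsuc))))

  ∑ℕ-∸ : ∀ n (g : Fin n → ℕ) → (∀ i → 1 ≤ g i) → ∑ℕ n g ∸ n ≡ ∑ℕ n (λ i → g i ∸ 1)
  ∑ℕ-∸ n g g≥1 = ≡.trans (≡.cong (_∸ n) (≡.sym (∑ℕ[g∸1]+n≡∑ℕg n g g≥1))) (ℕ.m+n∸n≡m _ n)

  *-cancelˡ-≉0 : ∀ {x y z} → ¬ x ≈ 0# → x * y ≈ x * z → y ≈ z
  *-cancelˡ-≉0 {x} {y} {z} x≉0 xy≈xz with inverse x x≉0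
  ... | x⁻¹ , xx⁻¹≈1 = begin
    y               ≈⟨ *-identityˡ y ⟨
    1# * y          ≈⟨ *-congʳ (trans (*-comm x⁻¹ x) xx⁻¹≈1) ⟨
    (x⁻¹ * x) * y   ≈⟨ *-assoc x⁻¹ x y ⟩
    x⁻¹ * (x * y)   ≈⟨ *-congˡ xy≈xz ⟩
    x⁻¹ * (x * z)   ≈⟨ *-assoc x⁻¹ x z ⟨
    (x⁻¹ * x) * z   ≈⟨ *-congʳ (trans (*-comm x⁻¹ x) xx⁻¹≈1) ⟩
    1# * z          ≈⟨ *-identityˡ z ⟩
    z               ∎

  *-≈0-cancelʳ : ∀ {x y} → ¬ y ≈ 0# → x * y ≈ 0# → x ≈ 0#
  *-≈0-cancelʳ {x} {y} y≉0 xy≈0 = *-cancelˡ-≉0 y≉0 (trans (*-comm y x) (trans xy≈0 (sym (zeroʳ y))))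

  ^-≉0 : ∀ {x} n → ¬ x ≈ 0# → ¬ x ^ n ≈ 0#
  ^-≉0 zero    x≉0 = 1≉0
  ^-≉0 (suc n) x≉0 xxⁿ≈0 = ^-≉0 n x≉0 (*-≈0-cancelʳ x≉0 (trans (*-comm _ _) xxⁿ≈0))

  proportional-last : ∀ {n} (w a b : Fin (suc n) → Carrier) x → ¬ w (fromℕ n) ≈ 0# →
    sum (λ j → w j * a j) ≈ 0# → sum (λ j → w j * b j) ≈ 0# →
    (∀ j → a (inject₁ j) ≈ x * b (inject₁ j)) → a (fromℕ n) ≈ x * b (fromℕ n)
  proportional-last {n} w a b x wₙ≉0 ∑wa≈0 ∑wb≈0 a≈xb = *-cancelˡ-≉0 wₙ≉0 (begin
    wₙ * a (fromℕ n)         ≈⟨ +-inverseʳ-unique A _ (trans (sym (sum-init-last (λ j → w j * a j))) ∑wa≈0) ⟩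
    - A                      ≈⟨ -‿cong A≈xB ⟩
    - (x * B)                ≈⟨ -‿distribʳ-* x B ⟩
    x * - B                  ≈⟨ *-congˡ (+-inverseʳ-unique B _ (trans (sym (sum-init-last (λ j → w j * b j))) ∑wb≈0)) ⟨
    x * (wₙ * b (fromℕ n))   ≈⟨ x∙yz≈y∙xz x wₙ _ ⟩
    wₙ * (x * b (fromℕ n))   ∎)
    where
    open CommSemigroupProperties *-commutativeSemigroup using (x∙yz≈y∙xz)
    wₙ = w (fromℕ n)
    A = sum (λ j → w (inject₁ j) * a (inject₁ j))
    B = sum (λ j → w (inject₁ j) * b (inject₁ j))
    A≈xB : A ≈ x * B
    A≈xB = begin
      A                                           ≈⟨ sum-cong-≋ (λ j → trans (*-congˡ (a≈xb j)) (x∙yz≈y∙xz _ x _)) ⟩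
      sum (λ j → x * (w (inject₁ j) * b (inject₁ j))) ≈⟨ *-distribˡ-sum x (λ j → w (inject₁ j) * b (inject₁ j)) ⟨
      x * B                                       ∎

module Characteristic {c ℓ} (F : Field c ℓ) where
  open Field F
  open FieldOps F
  open FieldProperties F using (^-≉0)
  open import Algebra.Properties.Ring ring using (+-identityʳ-unique)
  open import Algebra.Properties.Semiring.Exp semiring using (_^_)
  open import Algebra.Properties.Semiring.Mult semiring using (_×_; ×1-homo-*; ×-congˡ)
  open import Algebra.Properties.Semiring.Sum semiring using (sum; sum-permute; ∑-distrib-+; sum-replicate; sum-cong-≋)
  open import Relation.Binary.Reasoning.Setoid setoid

  ×1-^ : ∀ p e → (p ℕ.^ e) × 1# ≈ (p × 1#) ^ e
  ×1-^ p zero    = +-identityʳ 1#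
  ×1-^ p (suc e) = trans (×1-homo-* p (p ℕ.^ e)) (*-congˡ (×1-^ p e))

  -- Translation by 1 permutes the subfield, so Σ ι = Σ (ι + 1) = Σ ι + q × 1.
  q×1≈0 : ∀ {q} → ContainsFieldOfOrder q → q × 1# ≈ 0#
  q×1≈0 {q} (ι , ι-inj , _ , (o , ιo≈1) , +-closed , _ , neg-closed) =
    +-identityʳ-unique (sum ι) (q × 1#) (sym (begin
      sum ι                       ≈⟨ sum-permute ι translation ⟩
      sum (λ i → ι (σ i))         ≈⟨ sum-cong-≋ ισ≈ι+1 ⟩
      sum (λ i → ι i + 1#)        ≈⟨ ∑-distrib-+ ι (λ _ → 1#) ⟩
      sum ι + sum {q} (λ _ → 1#)  ≈⟨ +-congˡ (sum-replicate q) ⟩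
      sum ι + q × 1#              ∎))
    where
    +-cancelˡ-inverse : ∀ x y z → y + z ≈ 0# → (x + y) + z ≈ x
    +-cancelˡ-inverse x y z y+z≈0 = trans (+-assoc x y z) (trans (+-congˡ y+z≈0) (+-identityʳ x))
    m = proj₁ (neg-closed o)
    ιm≈-1 : ι m ≈ - 1#
    ιm≈-1 = trans (proj₂ (neg-closed o)) (-‿cong ιo≈1)
    σ σ⁻¹ : Fin q → Fin q
    σ i   = proj₁ (+-closed i o)
    σ⁻¹ i = proj₁ (+-closed i m)
    ισ≈ι+1 : ∀ i → ι (σ i) ≈ ι i + 1#
    ισ≈ι+1 i = trans (proj₂ (+-closed i o)) (+-congˡ ιo≈1)
    ισ⁻¹≈ι-1 : ∀ i → ι (σ⁻¹ i) ≈ ι i + - 1#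
    ισ⁻¹≈ι-1 i = trans (proj₂ (+-closed i m)) (+-congˡ ιm≈-1)
    translation = permutation σ σ⁻¹
      (λ i → ι-inj _ i (trans (ισ≈ι+1 _) (trans (+-congʳ (ισ⁻¹≈ι-1 i)) (+-cancelˡ-inverse _ _ _ (-‿inverseˡ 1#)))))
      (λ i → ι-inj _ i (trans (ισ⁻¹≈ι-1 _) (trans (+-congʳ (ισ≈ι+1 i)) (+-cancelˡ-inverse _ _ _ (-‿inverseʳ 1#)))))

  -- p × 1 lies in the subfield, where being 0 is decidable;
  -- were it nonzero, so would be (p × 1)^e = q × 1.
  p^e≡q⇒p×1≈0 : ∀ {p e q} → p ℕ.^ e ≡ q → ContainsFieldOfOrder q → p × 1# ≈ 0#
  p^e≡q⇒p×1≈0 {p} {e} {q} pᵉ≡q 𝔽q@(ι , ι-inj , (z , ιz≈0) , (o , ιo≈1) , +-closed , _) = decide (×1∈ p)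
    where
    ×1∈ : ∀ n → Σ (Fin q) λ k → ι k ≈ n × 1#
    ×1∈ zero    = z , ιz≈0
    ×1∈ (suc n) with k , ιk≈n×1 ← ×1∈ n =
      proj₁ (+-closed o k) , trans (proj₂ (+-closed o k)) (+-cong ιo≈1 ιk≈n×1)
    decide : (Σ (Fin q) λ k → ι k ≈ p × 1#) → p × 1# ≈ 0#
    decide (k , ιk≈p×1) with k ≟ᶠ z
    ... | yes ≡.refl = trans (sym ιk≈p×1) ιz≈0
    ... | no k≢z     = ⊥-elim (^-≉0 e p×1≉0 (begin
      (p × 1#) ^ e        ≈⟨ ×1-^ p e ⟨
      (p ℕ.^ e) × 1#      ≈⟨ ×-congˡ pᵉ≡q ⟩
      q × 1#              ≈⟨ q×1≈0 𝔽q ⟩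
      0#                  ∎))
      where
      p×1≉0 : ¬ p × 1# ≈ 0#
      p×1≉0 p×1≈0 = k≢z (ι-inj k z (trans ιk≈p×1 (trans p×1≈0 (sym ιz≈0))))

module Multiplicativity
  {c ℓ} (F : Field c ℓ) (q d : ℕ) (q≥2 : 2 ≤ q) (d≥1 : 1 ≤ d)
  (G : ℕ → Field.Carrier F) (w : ℕ → Fin (suc d) → Field.Carrier F)
  (w-last≉0 : ∀ t → ¬ Field._≈_ F (w t (fromℕ d)) (Field.0# F))
  where

  open Field F
  open FieldOps F
  open FieldProperties F using (proportional-last; ∏-cong; ∑ℕ-≤)
  open PowerSeries commutativeSemiring using (𝟙; 𝟙-+)
  open import Algebra.Properties.Semiring.Sum semiring using (sum)

  instance
    q≢0 : NonZero q
    q≢0 = ℕ.>-nonZero (ℕ.<-trans (s≤s z≤n) q≥2)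

  Recurrence : Set ℓ
  Recurrence = ∀ t N → sum (λ j → w t j * G (N ℕ.+ (q ℕ.^ (t ℕ.+ toℕ j) ∸ 1))) ≈ 0#

  Proportional : ℕ → Carrier → ℕ → Set ℓ
  Proportional N x k = G (N ℕ.+ (q ℕ.^ k ∸ 1)) ≈ x * G (q ℕ.^ k ∸ 1)

  index : ∀ s → (Fin s → ℕ) → ℕ
  index s k = ∑ℕ s (λ i → q ℕ.^ k i ∸ 1)

  ∏G : ∀ s → (Fin s → ℕ) → Carrier
  ∏G s k = ∏ s (λ i → G (q ℕ.^ k i ∸ 1))

  𝟙-∑ℕ : ∀ n (g : Fin n → ℕ) → 𝟙 (∑ℕ n g) ≈ ∏ n (𝟙 ∘ g)
  𝟙-∑ℕ zero    g = refl
  𝟙-∑ℕ (suc n) g = trans (𝟙-+ (g fzero) _) (*-congˡ (𝟙-∑ℕ n (g ∘ fsuc)))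

  small-index< : ∀ a (A : Fin a → ℕ) → a ≤ q → (∀ i → A i < d) → index a A < q ℕ.^ d ∸ 1
  small-index< a A a≤q A<d = begin-strict
    index a A                         ≤⟨ ∑ℕ-≤ a _ (λ i → ℕ.∸-monoˡ-≤ 1 (ℕ.^-monoʳ-≤ q (ℕ.<⇒≤pred (A<d i)))) ⟩
    a ℕ.* (q ℕ.^ d-1 ∸ 1)             ≤⟨ ℕ.*-monoˡ-≤ _ a≤q ⟩
    q ℕ.* (q ℕ.^ d-1 ∸ 1)             ≡⟨ ℕ.*-distribˡ-∸ q (q ℕ.^ d-1) 1 ⟩
    q ℕ.* q ℕ.^ d-1 ∸ q ℕ.* 1         ≡⟨ ≡.cong₂ _∸_ q^d≡q*q^[d-1] (≡.sym (ℕ.*-identityʳ q)) ⟨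
    q ℕ.^ d ∸ q                       <⟨ ℕ.∸-monoʳ-< q≥2 (m≤m^n q d≥1) ⟩
    q ℕ.^ d ∸ 1                       ∎
    where
    open ℕ.≤-Reasoning
    d-1 = ℕ.pred d
    q^d≡q*q^[d-1] : q ℕ.^ d ≡ q ℕ.* q ℕ.^ d-1
    q^d≡q*q^[d-1] = ≡.cong (q ℕ.^_) (≡.sym (ℕ.suc-pred d {{ℕ.>-nonZero d≥1}}))

  open import Relation.Binary.Reasoning.Setoid setoid

  module _ (recurrence : Recurrence) (initial : ∀ n → n < q ℕ.^ d ∸ 1 → G n ≈ 𝟙 n) where

    proportional-small⇒all : ∀ N x → (∀ j → j < d → Proportional N x j) → ∀ k → Proportional N x k
    proportional-small⇒all N x small = <-rec (Proportional N x) step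
      where
      step : ∀ k → (∀ {m} → m < k → Proportional N x m) → Proportional N x k
      step k smaller with k ℕ.<? d
      ... | yes k<d = small k k<d
      ... | no  k≮d = ≡.subst (Proportional N x) (≡.trans (≡.cong (t ℕ.+_) (toℕ-fromℕ d)) t+d≡k)
        (proportional-last (w t) (λ j → G (N ℕ.+ (q ℕ.^ (t ℕ.+ toℕ j) ∸ 1))) (λ j → G (q ℕ.^ (t ℕ.+ toℕ j) ∸ 1)) x
           (w-last≉0 t) (recurrence t N) (recurrence t 0) below-last)
        where
        t = k ∸ d
        t+d≡k : t ℕ.+ d ≡ k
        t+d≡k = ℕ.m∸n+n≡m (ℕ.≮⇒≥ k≮d)
        below-last : ∀ j → Proportional N x (t ℕ.+ toℕ (inject₁ j))
        below-last j = smaller (≡.subst (t ℕ.+ toℕ (inject₁ j) <_) t+d≡k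
          (ℕ.+-monoʳ-< t (≡.subst (_< d) (≡.sym (toℕ-inject₁ j)) (toℕ<n j))))

    multiplicative-small : ∀ a (A : Fin a → ℕ) → a ≤ q → (∀ i → A i < d) → G (index a A) ≈ ∏G a A
    multiplicative-small a A a≤q A<d = begin
      G (index a A)                        ≈⟨ initial _ (small-index< a A a≤q A<d) ⟩
      𝟙 (index a A)                        ≈⟨ 𝟙-∑ℕ a _ ⟩
      ∏ a (λ i → 𝟙 (q ℕ.^ A i ∸ 1))
        ≈⟨ ∏-cong a (λ i → sym (initial _ (ℕ.∸-monoˡ-< (ℕ.^-monoʳ-< q q≥2 (A<d i)) (ℕ.m^n>0 q (A i))))) ⟩
      ∏G a A                               ∎

    -- Exponents below d are moved into A; larger ones are reduced by proportional-small⇒all.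
    multiplicative : ∀ s (k : Fin s → ℕ) a (A : Fin a → ℕ) → a ℕ.+ s ≤ q → (∀ i → A i < d) →
                     G (index a A ℕ.+ index s k) ≈ ∏G a A * ∏G s k
    multiplicative zero k a A a+0≤q A<d = begin
      G (index a A ℕ.+ 0)  ≡⟨ ≡.cong G (ℕ.+-identityʳ _) ⟩
      G (index a A)        ≈⟨ multiplicative-small a A (≡.subst (_≤ q) (ℕ.+-identityʳ a) a+0≤q) A<d ⟩
      ∏G a A               ≈⟨ *-identityʳ _ ⟨
      ∏G a A * 1#          ∎
    multiplicative (suc s) k a A a+1+s≤q A<d = begin
      G (index a A ℕ.+ (q ℕ.^ k fzero ∸ 1 ℕ.+ index s (k ∘ fsuc)))
        ≡⟨ ≡.cong G (ℕ+.x∙yz≈xz∙y (index a A) _ _) ⟩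
      G (index a A ℕ.+ index s (k ∘ fsuc) ℕ.+ (q ℕ.^ k fzero ∸ 1))
        ≈⟨ proportional-small⇒all _ _ small (k fzero) ⟩
      ∏G a A * ∏G s (k ∘ fsuc) * G (q ℕ.^ k fzero ∸ 1)
        ≈⟨ *.x∙yz≈xz∙y (∏G a A) _ _ ⟨
      ∏G a A * ∏G (suc s) k ∎
      where
      module ℕ+ = CommSemigroupProperties ℕ.+-commutativeSemigroup
      module *  = CommSemigroupProperties *-commutativeSemigroup
      small : ∀ j → j < d → Proportional (index a A ℕ.+ index s (k ∘ fsuc)) (∏G a A * ∏G s (k ∘ fsuc)) j
      small j j<d = begin
        G (index a A ℕ.+ index s (k ∘ fsuc) ℕ.+ (q ℕ.^ j ∸ 1))
          ≡⟨ ≡.cong G (ℕ+.xy∙z≈yz∙x (q ℕ.^ j ∸ 1) _ _) ⟨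
        G (index (suc a) (j Vector.∷ A) ℕ.+ index s (k ∘ fsuc))
          ≈⟨ multiplicative s (k ∘ fsuc) (suc a) (j Vector.∷ A) (≡.subst (_≤ q) (ℕ.+-suc a s) a+1+s≤q) j∷A<d ⟩
        ∏G (suc a) (j Vector.∷ A) * ∏G s (k ∘ fsuc)
          ≈⟨ *.xy∙z≈yz∙x _ _ _ ⟩
        ∏G a A * ∏G s (k ∘ fsuc) * G (q ℕ.^ j ∸ 1) ∎
        where
        j∷A<d : ∀ i → (j Vector.∷ A) i < d
        j∷A<d fzero    = j<d
        j∷A<d (fsuc i) = A<d i

    G-multiplicative : ∀ s (k : Fin s → ℕ) → s ≤ q → G (index s k) ≈ ∏G s k
    G-multiplicative s k s≤q = trans (multiplicative s k 0 (λ ()) s≤q (λ ())) (*-identityˡ _)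

module Expansion
  {c ℓ} (F : Field c ℓ) (q d : ℕ) (q≥2 : 2 ≤ q) (f : Fin (suc d) → Field.Carrier F)
  (f-last≉0 : ¬ Field._≈_ F (f (fromℕ d)) (Field.0# F))
  (H : ℕ → Field.Carrier F) (expansion : FieldOps.IsExpansion F q d f H)
  where

  open Field F
  open FieldOps F
  open FieldProperties F using (∑≡sum; *-≈0-cancelʳ)
  open PowerSeries commutativeSemiring
  open import Algebra.Properties.Semiring.Exp semiring using (_^_)
  open import Algebra.Properties.Semiring.Mult semiring using (_×_)
  open import Algebra.Properties.Semiring.Sum semiring using (sum; sum-cong-≋; sum-init-last)
  open import Algebra.Properties.Semiring.Exp ⊕-⊛-semiring using () renaming (_^_ to _^ₛ_)
  open import Algebra.Properties.Semiring.Sum ⊕-⊛-semiring using () renaming (sum to sumₛ)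

  instance
    q≢0 : NonZero q
    q≢0 = ℕ.>-nonZero (ℕ.<-trans (s≤s z≤n) q≥2)

  q^j≤q^d : ∀ (j : Fin (suc d)) → q ℕ.^ toℕ j ≤ q ℕ.^ d
  q^j≤q^d j = ℕ.^-monoʳ-≤ q (ℕ.≤-pred (toℕ<n j))

  -- With u = 1/z, f(z) = u^(-q^d) P(u), where P has the coefficient f_j at u^(E j).
  E : Fin (suc d) → ℕ
  E j = q ℕ.^ d ∸ q ℕ.^ toℕ j

  P P₊ M : Series
  P  = sumₛ (λ j → monomial (f j) (E j))
  P₊ = sumₛ (λ j → monomial (f (fsuc j)) (E (fsuc j)))
  M  = monomial (- f fzero) (q ℕ.^ d ∸ 1)

  shiftedTerm≈shift : ∀ n (j : Fin (suc d)) → shiftedTerm q d n (toℕ j) (f j) H ≈ shift (E j) (f j ⊙ H) n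
  shiftedTerm≈shift n j with (n ℕ.+ q ℕ.^ toℕ j) ℕ.<? q ℕ.^ d
  ... | yes n+q^j<q^d = reflexive (≡.sym (shift-< (E j) _ (n+a<b⇒n<b∸a n+q^j<q^d)))
  ... | no  n+q^j≮q^d = reflexive (≡.sym (≡.trans (shift-≥ (E j) _ (n+a≮b⇒b∸a≤n n+q^j≮q^d))
                          (≡.cong (λ i → f j * H i) (≡.sym ([n+a]∸b≡n∸[b∸a] n (q^j≤q^d j))))))

  ∑shiftedTerm≈M : ∀ n → ∑ (suc d) (λ j → shiftedTerm q d n (toℕ j) (f j) H) ≈ M n
  ∑shiftedTerm≈M n with expansion n
  ... | ∑≈rhs with n ℕ.≟ q ℕ.^ d ∸ 1
  ...   | yes n≡e = trans ∑≈rhs (sym (trans (reflexive (≡.cong M n≡e)) (monomial-at (- f fzero) (q ℕ.^ d ∸ 1))))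
  ...   | no  n≢e = trans ∑≈rhs (sym (monomial-≢ (- f fzero) _ n≢e))

  H⊛P≋M : H ⊛ P ≋ M
  H⊛P≋M n = begin
    (H ⊛ P) n                                                ≈⟨ ⊛-sumₛ-monomial H f E n ⟩
    sum (λ j → shift (E j) (f j ⊙ H) n)                      ≈⟨ sum-cong-≋ (λ j → shiftedTerm≈shift n j) ⟨
    sum (λ j → shiftedTerm q d n (toℕ j) (f j) H)            ≡⟨ ∑≡sum (suc d) (λ j → shiftedTerm q d n (toℕ j) (f j) H) ⟨
    ∑ (suc d) (λ j → shiftedTerm q d n (toℕ j) (f j) H)      ≈⟨ ∑shiftedTerm≈M n ⟩
    M n                                                      ∎
    where open import Relation.Binary.Reasoning.Setoid setoid

  P₀≈f-last : P 0 ≈ f (fromℕ d)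
  P₀≈f-last = begin
    P 0                                                 ≈⟨ sumₛ-coeff (λ j → monomial (f j) (E j)) 0 ⟩
    sum (λ j → monomial (f j) (E j) 0)                  ≈⟨ sum-init-last (λ j → monomial (f j) (E j) 0) ⟩
    sum (λ j → monomial (f (inject₁ j)) (E (inject₁ j)) 0) + monomial (f (fromℕ d)) (E (fromℕ d)) 0
      ≈⟨ +-cong (sum-cong-≋ (λ j → monomial-≢ _ _ (0≢E j)))
                (reflexive (≡.cong (λ m → monomial (f (fromℕ d)) m 0) E-last≡0)) ⟩
    sum {d} (λ _ → 0#) + monomial (f (fromℕ d)) 0 0     ≈⟨ +-cong (sum-replicate-zero d) (*-identityʳ _) ⟩
    0# + f (fromℕ d)                                    ≈⟨ +-identityˡ _ ⟩
    f (fromℕ d)                                         ∎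
    where
    open import Relation.Binary.Reasoning.Setoid setoid
    open import Algebra.Properties.Semiring.Sum semiring using (sum-replicate-zero)
    E-last≡0 : E (fromℕ d) ≡ 0
    E-last≡0 = ≡.trans (≡.cong (λ k → q ℕ.^ d ∸ q ℕ.^ k) (toℕ-fromℕ d)) (ℕ.n∸n≡0 (q ℕ.^ d))
    0≢E : ∀ j → 0 ≢ E (inject₁ j)
    0≢E j = ℕ.<⇒≢ (ℕ.m<n⇒0<n∸m (ℕ.^-monoʳ-< q q≥2 (≡.subst (_< d) (≡.sym (toℕ-inject₁ j)) (toℕ<n j))))

  P₀-regular : ∀ x → x * P 0 ≈ 0# → x ≈ 0#
  P₀-regular x xP₀≈0 = *-≈0-cancelʳ f-last≉0 (trans (*-congˡ (sym P₀≈f-last)) xP₀≈0)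

  H-order : Order≥ H (q ℕ.^ d ∸ 1)
  H-order = order-⊛-cancelʳ P₀-regular (q ℕ.^ d ∸ 1)
    (λ i i<e → trans (H⊛P≋M i) (monomial-≢ (- f fzero) _ (ℕ.<⇒≢ i<e)))

  -- Adding 1 to H₀ cancels the f₀-term of P against M.
  Ĥ : Series
  Ĥ = H ⊕ 𝟙

  Ĥ⊛P≋P₊ : Ĥ ⊛ P ≋ P₊
  Ĥ⊛P≋P₊ = begin
    Ĥ ⊛ P                                            ≈⟨ ⊛-distribʳ H 𝟙 P ⟩
    H ⊛ P ⊕ 𝟙 ⊛ P                                    ≈⟨ ⊕-cong H⊛P≋M (⊛-identityˡ P) ⟩
    M ⊕ (monomial (f fzero) e ⊕ P₊)                  ≈⟨ (λ n → sym (+-assoc _ _ _)) ⟩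
    (M ⊕ monomial (f fzero) e) ⊕ P₊                  ≈⟨ ⊕-cong (monomial-+ (- f fzero) (f fzero) e) ≋-refl ⟩
    monomial (- f fzero + f fzero) e ⊕ P₊            ≈⟨ ⊕-cong (monomial-cong e (-‿inverseˡ (f fzero))) ≋-refl ⟩
    monomial 0# e ⊕ P₊                               ≈⟨ ⊕-cong (monomial-0# e) ≋-refl ⟩
    𝟘 ⊕ P₊                                           ≈⟨ (λ n → +-identityˡ _) ⟩
    P₊                                               ∎
    where
    open import Relation.Binary.Reasoning.Setoid (Semiring.setoid ⊕-⊛-semiring)
    e = q ℕ.^ d ∸ 1

  degree-P : Degree≤ P (q ℕ.^ d)
  degree-P = degree-sumₛ (λ j → monomial (f j) (E j))
    (λ j → degree-weaken (degree-monomial (f j) (E j)) (ℕ.m∸n≤m (q ℕ.^ d) (q ℕ.^ toℕ j)))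

  degree-P₊ : Degree≤ P₊ (q ℕ.^ d ∸ q)
  degree-P₊ = degree-sumₛ (λ j → monomial (f (fsuc j)) (E (fsuc j)))
    (λ j → degree-weaken (degree-monomial _ _) (ℕ.∸-monoʳ-≤ (q ℕ.^ d) (m≤m^n q {suc (toℕ j)} (s≤s z≤n))))

  -- Ĥ ⊛ P^Q = P₊ ⊛ P^(Q-1) has degree at most Q q^d - q, below the index N + Q q^d - 1.
  Ĥ⊛P^Q-vanishes : 1 ≤ d → ∀ Q N → 1 ≤ Q → (Ĥ ⊛ P ^ₛ Q) (N ℕ.+ (Q ℕ.* q ℕ.^ d ∸ 1)) ≈ 0#
  Ĥ⊛P^Q-vanishes d≥1 (suc Q) N _ =
    degree-resp (≋-trans (≋-sym (⊛-assoc Ĥ P (P ^ₛ Q))) (⊛-cong Ĥ⊛P≋P₊ ≋-refl))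
      (degree-⊛ _ _ degree-P₊ (degree-^ₛ Q degree-P)) _
      ([a∸q]+b<n+[a+b∸1] N (Q ℕ.* q ℕ.^ d) q≥2 (m≤m^n q d≥1))

  module _ {p} (p-prime : Prime p) (char : p × 1# ≈ 0#) where
    open Frobenius ⊕-⊛-semiring using (^[p^N]-distrib-sum)
    open import Algebra.Properties.Semiring.Sum ⊕-⊛-semiring using () renaming (sum-cong-≋ to sumₛ-cong)

    P^[p^N] : ∀ N → P ^ₛ (p ℕ.^ N) ≋ sumₛ (λ j → monomial (f j ^ (p ℕ.^ N)) (p ℕ.^ N ℕ.* E j))
    P^[p^N] N = ≋-trans (^[p^N]-distrib-sum p-prime (×ₛ-𝟙≋𝟘 {p} char) N _ (λ j → monomial-central (f j) (E j)))
                        (sumₛ-cong (λ j → monomial-^ₛ (f j) (E j) (p ℕ.^ N)))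

    Ĥ-recurrence : ∀ {e} → p ℕ.^ e ≡ q → 1 ≤ d → ∀ t N →
                   sum (λ j → f j ^ (q ℕ.^ t) * Ĥ (N ℕ.+ (q ℕ.^ (t ℕ.+ toℕ j) ∸ 1))) ≈ 0#
    Ĥ-recurrence {e} pᵉ≡q d≥1 t N = begin
      sum (λ j → f j ^ Q * Ĥ (N ℕ.+ (q ℕ.^ (t ℕ.+ toℕ j) ∸ 1)))  ≈⟨ sum-cong-≋ coefficient ⟨
      sum (λ j → shift (Q ℕ.* E j) ((f j ^ Q) ⊙ Ĥ) k)              ≈⟨ ⊛-sumₛ-monomial Ĥ (λ j → f j ^ Q) (λ j → Q ℕ.* E j) k ⟨
      (Ĥ ⊛ sumₛ (λ j → monomial (f j ^ Q) (Q ℕ.* E j))) k        ≈⟨ ⊛-cong ≋-refl P^Q k ⟨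
      (Ĥ ⊛ P ^ₛ Q) k                                            ≈⟨ Ĥ⊛P^Q-vanishes d≥1 Q N (ℕ.m^n>0 q t) ⟩
      0#                                                        ∎
      where
      open import Relation.Binary.Reasoning.Setoid setoid
      Q = q ℕ.^ t
      k = N ℕ.+ (Q ℕ.* q ℕ.^ d ∸ 1)
      P^Q : P ^ₛ Q ≋ sumₛ (λ j → monomial (f j ^ Q) (Q ℕ.* E j))
      P^Q = ≡.subst (λ Q → P ^ₛ Q ≋ sumₛ (λ j → monomial (f j ^ Q) (Q ℕ.* E j)))
              (≡.trans (≡.sym (ℕ.^-*-assoc p e t)) (≡.cong (ℕ._^ t) pᵉ≡q)) (P^[p^N] (e ℕ.* t))
      k≡ : ∀ (j : Fin (suc d)) → Q ℕ.* E j ℕ.+ (N ℕ.+ (q ℕ.^ (t ℕ.+ toℕ j) ∸ 1)) ≡ k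
      k≡ j = ≡.trans
        (≡.cong₂ (λ a b → a ℕ.+ (N ℕ.+ (b ∸ 1)))
          (ℕ.*-distribˡ-∸ Q (q ℕ.^ d) (q ℕ.^ toℕ j)) (ℕ.^-distribˡ-+-* q t (toℕ j)))
        ([a∸b]+[n+[b∸1]]≡n+[a∸1] N
          (ℕ.*-mono-≤ (ℕ.m^n>0 q t) (ℕ.m^n>0 q (toℕ j))) (ℕ.*-monoʳ-≤ Q (q^j≤q^d j)))
      coefficient : ∀ j → shift (Q ℕ.* E j) ((f j ^ Q) ⊙ Ĥ) k ≈ f j ^ Q * Ĥ (N ℕ.+ (q ℕ.^ (t ℕ.+ toℕ j) ∸ 1))
      coefficient j = reflexive (≡.trans
        (≡.cong (shift (Q ℕ.* E j) ((f j ^ Q) ⊙ Ĥ)) (≡.sym (k≡ j))) (shift-+ (Q ℕ.* E j) _ _))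

module WithPrimePowerSubfield
  {c ℓ} (F : Field c ℓ) {q p e} (p-prime : Prime p) (pᵉ≡q : p ℕ.^ e ≡ q) (e≥1 : e ≥ 1)
  (𝔽q : FieldOps.ContainsFieldOfOrder F q)
  where

  open Field F
  open FieldOps F
  open FieldProperties F using (^-≉0)
  open Characteristic F using (p^e≡q⇒p×1≈0)
  open PowerSeries commutativeSemiring using (_⊕_; 𝟙; order-⊛-cancelʳ)
  open import Algebra.Properties.Semiring.Exp semiring using (_^_)
  open import Algebra.Properties.Semiring.Mult semiring using (_×_)

  q≥2 : 2 ≤ q
  q≥2 = ≡.subst (2 ≤_) pᵉ≡q (ℕ.≤-trans (prime>1 p-prime) (m≤m^n p {{prime⇒nonZero p-prime}} e≥1))

  instance
    q≢0 : NonZero q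
    q≢0 = ℕ.>-nonZero (ℕ.<-trans (s≤s z≤n) q≥2)

  char : p × 1# ≈ 0#
  char = p^e≡q⇒p×1≈0 {p} {e} pᵉ≡q 𝔽q

  Ĥ-multiplicative : ∀ d (f : Fin (suc d) → Carrier) → ¬ f (fromℕ d) ≈ 0# → ∀ H → IsExpansion q d f H →
    ∀ s (k : Fin s → ℕ) → 1 ≤ s → s ≤ q →
    (H ⊕ 𝟙) (∑ℕ s (λ i → q ℕ.^ k i ∸ 1)) ≈ ∏ s (λ i → (H ⊕ 𝟙) (q ℕ.^ k i ∸ 1))
  Ĥ-multiplicative zero f f₀≉0 H expansion (suc s) k _ _ = trans (Ĥ≈0 _) (sym (trans (*-congʳ (Ĥ≈0 _)) (zeroˡ _)))
    where
    open Expansion F q 0 q≥2 f f₀≉0 H expansion using (Ĥ; Ĥ⊛P≋P₊; P₀-regular)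
    -- For d = 0, P₊ is the empty sum, so Ĥ ⊛ P ≋ 𝟘.
    Ĥ≈0 : ∀ n → Ĥ n ≈ 0#
    Ĥ≈0 n = order-⊛-cancelʳ P₀-regular (suc n) (λ i _ → Ĥ⊛P≋P₊ i) n ℕ.≤-refl
  Ĥ-multiplicative (suc d) f f-last≉0 H expansion s k _ s≤q =
    G-multiplicative (Ĥ-recurrence p-prime char {e} pᵉ≡q (s≤s z≤n)) Ĥ-initial s k s≤q
    where
    open Expansion F q (suc d) q≥2 f f-last≉0 H expansion using (Ĥ; Ĥ-recurrence; H-order)
    open Multiplicativity F q (suc d) q≥2 (s≤s z≤n) Ĥ (λ t j → f j ^ (q ℕ.^ t)) (λ t → ^-≉0 (q ℕ.^ t) f-last≉0)
      using (G-multiplicative)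
    Ĥ-initial : ∀ n → n < q ℕ.^ suc d ∸ 1 → Ĥ n ≈ 𝟙 n
    Ĥ-initial n n<e = trans (+-congʳ (H-order n n<e)) (+-identityˡ (𝟙 n))

  q^k∸1≥1 : ∀ {k} → 1 ≤ k → 1 ≤ q ℕ.^ k ∸ 1
  q^k∸1≥1 k≥1 = ℕ.∸-monoˡ-≤ 1 (ℕ.≤-trans q≥2 (m≤m^n q k≥1))

  ∑ℕ[q^k∸1]≥1 : ∀ s (k : Fin s → ℕ) → 1 ≤ s → (∀ i → 1 ≤ k i) → 1 ≤ ∑ℕ s (λ i → q ℕ.^ k i ∸ 1)
  ∑ℕ[q^k∸1]≥1 (suc s) k _ k≥1 = ℕ.≤-trans (q^k∸1≥1 (k≥1 fzero)) (ℕ.m≤m+n _ _)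

-- Opened only here: above, _^_ is exponentiation in a semiring.
open import Data.Nat using (_^_)

theorem3 : {c ℓ : Level} (F : Field c ℓ) (q : ℕ) → IsPrimePower q →
    FieldOps.ContainsFieldOfOrder F q →
    (d : ℕ) (f : Fin (suc d) → Field.Carrier F) →
    ¬ (Field._≈_ F (f (Data.Fin.fromℕ d)) (Field.0# F)) →
    (H : ℕ → Field.Carrier F) → FieldOps.IsExpansion F q d f H →
    (s : ℕ) → 1 ≤ s → s ≤ q → (k : Fin s → ℕ) → (∀ i → k i ≥ 1) →
    Field._≈_ F (FieldOps.∏ F s (λ i → H (q ^ k i ∸ 1)))
      (H (FieldOps.∑ℕ F s (λ i → q ^ k i) ∸ s))
theorem3 F q (p , e , p-prime , e≥1 , q≡pᵉ) 𝔽q d f f-last≉0 H expansion s s≥1 s≤q k k≥1 = begin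
  ∏ s (λ i → H (q ^ k i ∸ 1))             ≈⟨ ∏-cong s (λ i → ⊕𝟙-coeff H (q^k∸1≥1 (k≥1 i))) ⟨
  ∏ s (λ i → (H ⊕ 𝟙) (q ^ k i ∸ 1))       ≈⟨ Ĥ-multiplicative d f f-last≉0 H expansion s k s≥1 s≤q ⟨
  (H ⊕ 𝟙) (∑ℕ s (λ i → q ^ k i ∸ 1))      ≈⟨ ⊕𝟙-coeff H (∑ℕ[q^k∸1]≥1 s k s≥1 k≥1) ⟩
  H (∑ℕ s (λ i → q ^ k i ∸ 1))            ≡⟨ ≡.cong H (∑ℕ-∸ s (λ i → q ^ k i) (λ i → ℕ.m^n>0 q (k i))) ⟨
  H (∑ℕ s (λ i → q ^ k i) ∸ s)            ∎
  where
  open Field F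
  open FieldOps F
  open FieldProperties F using (∏-cong; ∑ℕ-∸)
  open PowerSeries commutativeSemiring using (_⊕_; 𝟙; ⊕𝟙-coeff)
  open WithPrimePowerSubfield F p-prime (≡.sym q≡pᵉ) e≥1 𝔽q
  open import Relation.Binary.Reasoning.Setoid setoid
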